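{- Let $k$ be a positive integer. Let $G$ be a chain of order $n$ with bridgeless components $C_1,\dots,C_t$ (numbered as in the definition of a chain), and let $\eta$ be the total number of vertices in the nontrivial bridgeless components of $G$. Let $\alpha$ be a special ordering of $G$ with $\mathrm{prf}_\alpha(G)\le n-1+k$. Then $\eta\le 3k$.
   Context: An ordering of a graph $G=(V,E)$ is a bijection $\alpha:V\to\{1,\dots,|V|\}$, and with $N[v]=\{v\}\cup\{u:uv\in E\}$ its profile is $\mathrm{prf}_\alpha(G)=\sum_{v\in V}(\alpha(v)-\min\{\alpha(u):u\in N[v]\})$. The bridgeless components of a graph are the connected components of the graph obtained by deleting all bridges; a bridgeless component is nontrivial if it has more than one vertex, trivial otherwise. A connected graph $G$ is a chain of length $t$ if its bridgeless components can be numbered $C_1,\dots,C_t$ (so $V(G)=\bigcup_{i=1}^t V(C_i)$) such that for each $1\le i\le t-1$, $C_i$ is joined to $C_{i+1}$ by a bridge. An ordering $\alpha$ of such a chain is special if for all $x\in V(C_i)$, $y\in V(C_j)$ with $i<j$ we have $\alpha(x)<\alpha(y)$. -}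

module Defs where

open import Data.Nat using (ℕ; zero; suc; _+_; _∸_; _<_; _⊔_; _⊓_)
open import Data.Fin using (Fin; toℕ; _≟_)
open import Data.Bool using (Bool; true; false; if_then_else_; not; _∧_)
open import Data.List using (List; foldr; map; allFin; length; filterᵇ)
open import Data.Nat.ListAction using (sum)
open import Data.Bool.ListAction using (any)
open import Data.Product using (Σ; _×_; ∃; ∃-syntax; _,_)
open import Data.Sum using (_⊎_)
open import Relation.Nullary using (¬_; does)
open import Relation.Binary.PropositionalEquality using (_≡_)
open import Data.Fin.Permutation using (Permutation′; _⟨$⟩ʳ_)

record Graph (n : ℕ) : Set where
  field
    adj    : Fin n → Fin n → Bool
    sym    : ∀ u v → adj u v ≡ adj v u
    irrefl : ∀ v → adj v v ≡ false
open Graph public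

module _ {n : ℕ} where

  E : Graph n → Fin n → Fin n → Set
  E G u v = adj G u v ≡ true

  data Reach (R : Fin n → Fin n → Set) : Fin n → Fin n → Set where
    here : ∀ {u} → Reach R u u
    step : ∀ {u w v} → R u w → Reach R w v → Reach R u v

  Connected : Graph n → Set
  Connected G = ∀ u v → Reach (E G) u v

  EdgeWithout : Graph n → Fin n → Fin n → Fin n → Fin n → Set
  EdgeWithout G a b u v = E G u v × ¬ ((u ≡ a × v ≡ b) ⊎ (u ≡ b × v ≡ a))

  IsBridge : Graph n → Fin n → Fin n → Set
  IsBridge G a b = E G a b × ¬ Reach (EdgeWithout G a b) a b

  NonBridgeEdge : Graph n → Fin n → Fin n → Set
  NonBridgeEdge G u v = E G u v × ¬ IsBridge G u v

  SameBC : Graph n → Fin n → Fin n → Set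
  SameBC G u v = Reach (NonBridgeEdge G) u v

  -- G is a chain of length t, with c v ∈ {0,…,t-1} the (0-based) index of
  -- the bridgeless component C_{c v + 1} containing v.
  record IsChain (G : Graph n) (t : ℕ) (c : Fin n → Fin t) : Set where
    field
      connected : Connected G
      c-sound   : ∀ u v → c u ≡ c v → SameBC G u v
      c-complete : ∀ u v → SameBC G u v → c u ≡ c v
      c-onto    : ∀ (i : Fin t) → ∃[ v ] c v ≡ i
      linked    : ∀ (i : ℕ) → suc i < t →
                  ∃[ x ] ∃[ y ] (toℕ (c x) ≡ i × toℕ (c y) ≡ suc i × IsBridge G x y)

  -- the ordering α (0-based: α v ∈ {0,…,n-1}) given by a permutation
  ord : Permutation′ n → Fin n → ℕ
  ord π v = toℕ (π ⟨$⟩ʳ v)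

  Special : ∀ {t} → (Fin n → Fin t) → Permutation′ n → Set
  Special c π = ∀ x y → toℕ (c x) < toℕ (c y) → ord π x < ord π y

  -- min { α(u) : u ∈ N[v] }
  minClosedNbr : Graph n → Permutation′ n → Fin n → ℕ
  minClosedNbr G π v =
    foldr (λ u m → if adj G v u then ord π u ⊓ m else m) (ord π v) (allFin n)

  profile : Graph n → Permutation′ n → ℕ
  profile G π = sum (map (λ v → ord π v ∸ minClosedNbr G π v) (allFin n))

  inNontrivial : ∀ {t} → (Fin n → Fin t) → Fin n → Bool
  inNontrivial c v = any (λ u → not (does (u ≟ v)) ∧ does (c u ≟ c v)) (allFin n)

  eta : ∀ {t} → (Fin n → Fin t) → ℕ
  eta c = length (filterᵇ (inNontrivial c) (allFin n))

-- Write α for the ordering and μ v for the least position in N[v].  The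
-- profile is at least the sum over the gaps q < n of the width
-- w(q) = #{v : μ v ≤ q < α v}.  Connectivity gives w(q) ≥ 1 for every
-- q < n - 1, so at most k gaps have width at least 2.  In a bridgeless
-- component every cut separating two of its vertices is crossed by two
-- edges; applied to the cuts {x} and {w : α w ≤ α x} this shows that a
-- vertex x followed by another vertex of its component has w(α x) ≥ 2 or
-- w(α x - 1) ≥ 2.  A special ordering keeps each component contiguous, so
-- every vertex of a nontrivial component lies at most two positions after a
-- gap of width at least 2, and each such gap is charged by at most three
-- vertices.
module Submission where

open import Defs hiding (sym)
open import Data.Nat using (ℕ; zero; suc; pred; _+_; _*_; _∸_; _≤_; _<_; _⊓_; z≤n; s≤s)
open import Data.Nat.Properties
open import Data.Fin using (Fin; toℕ; zero; suc; fromℕ<) renaming (_≟_ to _≟ᶠ_)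
open import Data.Fin.Properties using (toℕ-injective; toℕ<n; toℕ-fromℕ<; any?)
open import Data.Fin.Permutation using (Permutation′; _⟨$⟩ʳ_; _⟨$⟩ˡ_; inverseˡ; inverseʳ)
open import Data.Bool using (Bool; true; false; if_then_else_; T)
import Data.Bool as Bool
open import Data.Bool.Properties using (T-≡)
open import Data.List using ([]; _∷_; map; tabulate; length; filterᵇ; foldr; allFin)
import Data.Nat.ListAction as List
open import Data.List.Relation.Unary.Any using (satisfied)
open import Data.List.Relation.Unary.Any.Properties using (any⁻)
open import Data.Product using (∃-syntax; _×_; _,_; proj₁; proj₂)
open import Data.Sum using (_⊎_; inj₁; inj₂)
open import Function using (_∘_; Equivalence)
open import Relation.Nullary using (¬_; contradiction; Dec; yes; no; does; _×-dec_; _⊎-dec_)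
open import Relation.Nullary.Decidable using (dec-true; dec-false; decidable-stable)
open import Relation.Nullary.Negation using (¬¬-map)
open import Relation.Unary using (Pred; Decidable)
open import Relation.Binary.Definitions using (tri<; tri≈; tri>)
open import Relation.Binary.PropositionalEquality
  using (_≡_; _≢_; refl; sym; trans; cong; cong₂; subst; module ≡-Reasoning)
open import Algebra.Properties.Semiring.Sum +-*-semiring
  using (sum; sum-syntax; sum-cong-≗; sum-replicate-zero; ∑-comm; ∑-distrib-+; ∑-permute;
         *-distribˡ-sum; *-distribʳ-sum)

n≤1+pred[n] : ∀ n → n ≤ suc (pred n)
n≤1+pred[n] zero    = z≤n
n≤1+pred[n] (suc n) = ≤-refl

m<n⇒pred[n]<n : ∀ {m n} → m < n → pred n < n
m<n⇒pred[n]<n {n = suc n} _ = ≤-refl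

m<n∸1⇒1+m<n : ∀ {m n} → m < n ∸ 1 → suc m < n
m<n∸1⇒1+m<n {n = suc n} m<n∸1 = s≤s m<n∸1

𝟙 : ∀ {p} {P : Set p} → Dec P → ℕ
𝟙 d = if does d then 1 else 0

𝟙-yes : ∀ {p} {P : Set p} (d : Dec P) → P → 𝟙 d ≡ 1
𝟙-yes d p rewrite dec-true d p = refl

𝟙-no : ∀ {p} {P : Set p} (d : Dec P) → ¬ P → 𝟙 d ≡ 0
𝟙-no d ¬p rewrite dec-false d ¬p = refl

𝟙≤1 : ∀ {p} {P : Set p} (d : Dec P) → 𝟙 d ≤ 1
𝟙≤1 (yes _) = ≤-refl
𝟙≤1 (no _)  = z≤n

∑-mono-≤ : ∀ {n} {f g : Fin n → ℕ} → (∀ i → f i ≤ g i) → sum f ≤ sum g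
∑-mono-≤ {zero}  f≤g = z≤n
∑-mono-≤ {suc n} f≤g = +-mono-≤ (f≤g zero) (∑-mono-≤ (f≤g ∘ suc))

term≤∑ : ∀ {n} (f : Fin n → ℕ) i → f i ≤ sum f
term≤∑ f zero    = m≤m+n _ _
term≤∑ f (suc i) = ≤-trans (term≤∑ (f ∘ suc) i) (m≤n+m _ _)

term+term≤∑ : ∀ {n} (f : Fin n → ℕ) {i j} → i ≢ j → f i + f j ≤ sum f
term+term≤∑ f {zero}  {zero}  i≢j = contradiction refl i≢j
term+term≤∑ f {zero}  {suc j} _   = +-monoʳ-≤ (f zero) (term≤∑ (f ∘ suc) j)
term+term≤∑ f {suc i} {zero}  _   =
  ≤-trans (≤-reflexive (+-comm (f (suc i)) (f zero))) (+-monoʳ-≤ (f zero) (term≤∑ (f ∘ suc) i))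
term+term≤∑ f {suc i} {suc j} i≢j =
  ≤-trans (term+term≤∑ (f ∘ suc) (i≢j ∘ cong suc)) (m≤n+m _ _)

Between : ℕ → ℕ → ℕ → Set
Between m a p = m ≤ p × p < a

between? : ∀ m a p → Dec (Between m a p)
between? m a p = (m ≤? p) ×-dec (p <? a)

-- The case m = suc m′ is split once more only so that the shifted indicators
-- reduce to the unshifted ones.
∑-between≤ : ∀ N m a → ∑[ p < N ] 𝟙 (between? m a (toℕ p)) ≤ a ∸ m
∑-between≤ zero    m             a       = z≤n
∑-between≤ (suc N) m             zero    =
  ≤-trans (∑-mono-≤ {suc N} (λ p → ≤-reflexive (𝟙-no (between? m 0 (toℕ p)) (n≮0 ∘ proj₂))))
          (≤-reflexive (trans (sum-replicate-zero (suc N)) (sym (0∸n≡0 m))))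
∑-between≤ (suc N) zero          (suc a) = s≤s (∑-between≤ N zero a)
∑-between≤ (suc N) (suc zero)    (suc a) = ∑-between≤ N zero a
∑-between≤ (suc N) (suc (suc m)) (suc a) = ∑-between≤ N (suc m) a

∑-below≡ : ∀ N M → ∑[ p < N ] 𝟙 (toℕ p <? M) ≡ N ⊓ M
∑-below≡ zero    M       = refl
∑-below≡ (suc N) zero    = sum-replicate-zero N
∑-below≡ (suc N) (suc M) = cong suc (∑-below≡ N M)

sum-map-tabulate : ∀ {a} {A : Set a} {n} (f : A → ℕ) (g : Fin n → A) →
                   List.sum (map f (tabulate g)) ≡ ∑[ i < n ] f (g i)
sum-map-tabulate {n = zero}  f g = refl
sum-map-tabulate {n = suc n} f g = cong (f (g zero) +_) (sum-map-tabulate f (g ∘ suc))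

length-filterᵇ≤sum-map : ∀ {a} {A : Set a} (p : A → Bool) (f : A → ℕ) →
                         (∀ x → T (p x) → 1 ≤ f x) →
                         ∀ xs → length (filterᵇ p xs) ≤ List.sum (map f xs)
length-filterᵇ≤sum-map p f p⇒1≤f []       = z≤n
length-filterᵇ≤sum-map p f p⇒1≤f (x ∷ xs) with p x in px
... | true  = +-mono-≤ (p⇒1≤f x (Equivalence.from T-≡ px)) (length-filterᵇ≤sum-map p f p⇒1≤f xs)
... | false = ≤-trans (length-filterᵇ≤sum-map p f p⇒1≤f xs) (m≤n+m _ (f x))

module _ {n : ℕ} (π : Permutation′ n) where

  ord-injective : ∀ {x y} → ord π x ≡ ord π y → x ≡ y
  ord-injective {x} {y} eq = begin
    x                            ≡⟨ inverseˡ π ⟨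
    π ⟨$⟩ˡ (π ⟨$⟩ʳ x)            ≡⟨ cong (π ⟨$⟩ˡ_) (toℕ-injective eq) ⟩
    π ⟨$⟩ˡ (π ⟨$⟩ʳ y)            ≡⟨ inverseˡ π ⟩
    y                            ∎
    where open ≡-Reasoning

  ord-surjective : ∀ {q} → q < n → ∃[ x ] ord π x ≡ q
  ord-surjective q<n = π ⟨$⟩ˡ fromℕ< q<n , trans (cong toℕ (inverseʳ π)) (toℕ-fromℕ< q<n)

  ∑-between-ord≤ : ∀ m a → ∑[ v < n ] 𝟙 (between? m a (ord π v)) ≤ a ∸ m
  ∑-between-ord≤ m a = begin
    ∑[ v < n ] 𝟙 (between? m a (ord π v))  ≡⟨ ∑-permute (λ p → 𝟙 (between? m a (toℕ p))) π ⟨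
    ∑[ p < n ] 𝟙 (between? m a (toℕ p))    ≤⟨ ∑-between≤ n m a ⟩
    a ∸ m                                  ∎
    where open ≤-Reasoning

  special⇒contiguous : ∀ {t} {c : Fin n → Fin t} → Special c π →
                       ∀ {u x w} → c u ≡ c w → ord π u ≤ ord π x → ord π x ≤ ord π w → c x ≡ c w
  special⇒contiguous {c = c} special {u} {x} {w} cu≡cw u≤x x≤w with <-cmp (toℕ (c x)) (toℕ (c w))
  ... | tri< cx<cw _ _ =
    contradiction u≤x (<⇒≱ (special x u (subst (λ i → toℕ (c x) < toℕ i) (sym cu≡cw) cx<cw)))
  ... | tri≈ _ cx≡cw _ = toℕ-injective cx≡cw
  ... | tri> _ _ cw<cx = contradiction x≤w (<⇒≱ (special w x cw<cx))

record Crossing {n : ℕ} (R : Fin n → Fin n → Set) (P : Pred (Fin n) _) : Set where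
  field
    from to : Fin n
    edge    : R from to
    inside  : P from
    outside : ¬ P to

open Crossing public

Reach⇒Crossing : ∀ {n} {R : Fin n → Fin n → Set} {P : Pred (Fin n) _} → Decidable P →
                 ∀ {x y} → Reach R x y → P x → ¬ P y → Crossing R P
Reach⇒Crossing P? here px ¬py = contradiction px ¬py
Reach⇒Crossing P? (step {w = w} r rest) px ¬pw with P? w
... | yes pw  = Reach⇒Crossing P? rest pw ¬pw
... | no ¬pw′ = record { from = _ ; to = w ; edge = r ; inside = px ; outside = ¬pw′ }

module _ {n : ℕ} (G : Graph n) where

  record TwoCrossings (P : Pred (Fin n) _) : Set where
    field
      first second : Crossing (E G) P
      distinct     : ¬ (from first ≡ from second × to first ≡ to second)

  E-sym : ∀ {u v} → E G u v → E G v u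
  E-sym {u} {v} e = trans (Graph.sym G v u) e

  -- A crossing non-bridge edge ab leaves a and b joined in G − ab, and that
  -- walk has to cross the cut at a second edge.
  sameBC⇒twoCrossings : ∀ {P : Pred (Fin n) _} → Decidable P →
                        ∀ {x y} → SameBC G x y → P x → ¬ P y → ¬ ¬ TwoCrossings P
  sameBC⇒twoCrossings {P} P? x~y px ¬py ¬two =
    notBridge (ab , λ a~b → ¬two (viaDetour (Reach⇒Crossing P? a~b (inside c) (outside c))))
    where
    c : Crossing (NonBridgeEdge G) P
    c = Reach⇒Crossing P? x~y px ¬py
    ab : E G (from c) (to c)
    ab = proj₁ (edge c)
    notBridge : ¬ IsBridge G (from c) (to c)
    notBridge = proj₂ (edge c)
    viaDetour : Crossing (EdgeWithout G (from c) (to c)) P → TwoCrossings P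
    viaDetour d = record
      { first    = record { from = from c ; to = to c ; edge = ab ; inside = inside c ; outside = outside c }
      ; second   = record { from = from d ; to = to d ; edge = proj₁ (edge d) ; inside = inside d ; outside = outside d }
      ; distinct = λ (a≡a′ , b≡b′) → proj₂ (edge d) (inj₁ (sym a≡a′ , sym b≡b′))
      }

module Gaps {n : ℕ} (G : Graph n) (π : Permutation′ n) where

  α : Fin n → ℕ
  α = ord π

  μ : Fin n → ℕ
  μ = minClosedNbr G π

  Spans : Fin n → ℕ → Set
  Spans v q = Between (μ v) (α v) q

  width : ℕ → ℕ
  width q = ∑[ v < n ] 𝟙 (between? (μ v) (α v) q)

  Good : ℕ → Set
  Good q = 2 ≤ width q

  good? : ∀ q → Dec (Good q)
  good? q = 2 ≤? width q

  goodGaps : ℕ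
  goodGaps = ∑[ q < n ] 𝟙 (good? (toℕ q))

  foldr-min≤ : ∀ v {k} (h : Fin k → Fin n) j → E G v (h j) →
               foldr (λ u m → if adj G v u then ord π u ⊓ m else m) (α v) (tabulate h) ≤ α (h j)
  foldr-min≤ v h zero    vh rewrite vh = m⊓n≤m _ _
  foldr-min≤ v h (suc j) vh with adj G v (h zero)
  ... | true  = ≤-trans (m⊓n≤n _ _) (foldr-min≤ v (h ∘ suc) j vh)
  ... | false = foldr-min≤ v (h ∘ suc) j vh

  μ≤α-neighbour : ∀ {v u} → E G v u → μ v ≤ α u
  μ≤α-neighbour {v} {u} = foldr-min≤ v (λ i → i) u

  spans-later-end : ∀ {a b q} → E G a b → α a ≤ q → q < α b → Spans b q
  spans-later-end ab a≤q q<b = ≤-trans (μ≤α-neighbour (E-sym G ab)) a≤q , q<b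

  spans⇒width≥1 : ∀ {v q} → Spans v q → 1 ≤ width q
  spans⇒width≥1 {v} {q} v↝q =
    ≤-trans (≤-reflexive (sym (𝟙-yes (between? (μ v) (α v) q) v↝q)))
            (term≤∑ (λ w → 𝟙 (between? (μ w) (α w) q)) v)

  spans⇒good : ∀ {v w q} → v ≢ w → Spans v q → Spans w q → Good q
  spans⇒good {v} {w} {q} v≢w v↝q w↝q =
    ≤-trans (≤-reflexive (sym (cong₂ _+_ (𝟙-yes (between? (μ v) (α v) q) v↝q)
                                          (𝟙-yes (between? (μ w) (α w) q) w↝q))))
            (term+term≤∑ (λ u → 𝟙 (between? (μ u) (α u) q)) v≢w)

  ∑width≤profile : ∑[ q < n ] width (toℕ q) ≤ profile G π
  ∑width≤profile = begin
    ∑[ q < n ] ∑[ v < n ] 𝟙 (between? (μ v) (α v) (toℕ q))  ≡⟨ ∑-comm {n} {n} (λ q v → 𝟙 (between? (μ v) (α v) (toℕ q))) ⟩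
    ∑[ v < n ] ∑[ q < n ] 𝟙 (between? (μ v) (α v) (toℕ q))  ≤⟨ ∑-mono-≤ {n} (λ v → ∑-between≤ n (μ v) (α v)) ⟩
    ∑[ v < n ] (α v ∸ μ v)                                   ≡⟨ sum-map-tabulate (λ v → α v ∸ μ v) (λ v → v) ⟨
    profile G π                                              ∎
    where open ≤-Reasoning

  connected⇒width≥1 : Connected G → ∀ {q} → q < n ∸ 1 → 1 ≤ width q
  connected⇒width≥1 connected {q} q<n∸1 = spans⇒width≥1 (spans-later-end (edge cut) (inside cut) (≰⇒> (outside cut)))
    where
    1+q<n : suc q < n
    1+q<n = m<n∸1⇒1+m<n q<n∸1
    atQ : ∃[ x ] α x ≡ q
    atQ = ord-surjective π (<-trans (n<1+n q) 1+q<n)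
    atSucQ : ∃[ x ] α x ≡ suc q
    atSucQ = ord-surjective π 1+q<n
    cut : Crossing (E G) (λ w → α w ≤ q)
    cut = Reach⇒Crossing (λ w → α w ≤? q) (connected (proj₁ atQ) (proj₁ atSucQ))
            (≤-reflexive (proj₂ atQ)) (λ xl≤q → n≮n q (subst (_≤ q) (proj₂ atSucQ) xl≤q))

  width≥gap+good : Connected G → ∀ q → 𝟙 (q <? n ∸ 1) + 𝟙 (good? q) ≤ width q
  width≥gap+good connected q = bound (q <? n ∸ 1) (good? q)
    where
    bound : (gap? : Dec (q < n ∸ 1)) (isGood? : Dec (Good q)) → 𝟙 gap? + 𝟙 isGood? ≤ width q
    bound gap?         (yes good) = ≤-trans (+-monoˡ-≤ 1 (𝟙≤1 gap?)) good
    bound (yes q<n∸1) (no _)     = connected⇒width≥1 connected q<n∸1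
    bound (no _)      (no _)     = z≤n

  n∸1+goodGaps≤profile : Connected G → n ∸ 1 + goodGaps ≤ profile G π
  n∸1+goodGaps≤profile connected = begin
    n ∸ 1 + goodGaps                                        ≡⟨ cong (_+ goodGaps) n∸1≡∑gaps ⟩
    ∑[ q < n ] 𝟙 (toℕ q <? n ∸ 1) + goodGaps                ≡⟨ ∑-distrib-+ {n} (λ q → 𝟙 (toℕ q <? n ∸ 1)) (λ q → 𝟙 (good? (toℕ q))) ⟨
    ∑[ q < n ] (𝟙 (toℕ q <? n ∸ 1) + 𝟙 (good? (toℕ q)))    ≤⟨ ∑-mono-≤ {n} (λ q → width≥gap+good connected (toℕ q)) ⟩
    ∑[ q < n ] width (toℕ q)                                ≤⟨ ∑width≤profile ⟩
    profile G π                                             ∎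
    where
    open ≤-Reasoning
    n∸1≡∑gaps : n ∸ 1 ≡ ∑[ q < n ] 𝟙 (toℕ q <? n ∸ 1)
    n∸1≡∑gaps = trans (sym (m≥n⇒m⊓n≡n (m∸n≤m n 1))) (sym (∑-below≡ n (n ∸ 1)))

  noEarlierNeighbour⇒good : ∀ {x} → (∀ {a} → E G x a → α x ≤ α a) → TwoCrossings G (_≡ x) → Good (α x)
  noEarlierNeighbour⇒good {x} x≤nbrs two = spans⇒good b₁≢b₂ (spansAtX first) (spansAtX second)
    where
    open TwoCrossings two
    spansAtX : (c : Crossing (E G) (_≡ x)) → Spans (to c) (α x)
    spansAtX c = spans-later-end xb ≤-refl (≤∧≢⇒< (x≤nbrs xb) (outside c ∘ ord-injective π ∘ sym))
      where
      xb : E G x (to c)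
      xb = subst (λ a → E G a (to c)) (inside c) (edge c)
    b₁≢b₂ : to first ≢ to second
    b₁≢b₂ b₁≡b₂ = distinct (trans (inside first) (sym (inside second)) , b₁≡b₂)

  earlierNeighbour⇒good : ∀ {a x} → E G a x → α a < α x → TwoCrossings G (λ w → α w ≤ α x) →
                          Good (α x) ⊎ Good (pred (α x))
  earlierNeighbour⇒good {a} {x} ax a<x two = byEnds (to first ≟ᶠ to second)
    where
    open TwoCrossings two
    spansAtX : (c : Crossing (E G) (λ w → α w ≤ α x)) → Spans (to c) (α x)
    spansAtX c = spans-later-end (edge c) (inside c) (≰⇒> (outside c))
    spansBeforeX : (c : Crossing (E G) (λ w → α w ≤ α x)) → from c ≢ x → Spans (to c) (pred (α x))
    spansBeforeX c a≢x =
      spans-later-end (edge c) (<⇒≤pred (≤∧≢⇒< (inside c) (a≢x ∘ ord-injective π)))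
                      (≤-<-trans pred[n]≤n (≰⇒> (outside c)))
    xSpans : Spans x (pred (α x))
    xSpans = spans-later-end ax (<⇒≤pred a<x) (m<n⇒pred[n]<n a<x)
    endNotX : (c : Crossing (E G) (λ w → α w ≤ α x)) → to c ≢ x
    endNotX c b≡x = outside c (≤-reflexive (cong α b≡x))
    -- With a common end b, one crossing starts strictly before x, so b and x
    -- both span the gap just before x.
    byEnds : Dec (to first ≡ to second) → Good (α x) ⊎ Good (pred (α x))
    byEnds (no b₁≢b₂) = inj₁ (spans⇒good b₁≢b₂ (spansAtX first) (spansAtX second))
    byEnds (yes b₁≡b₂) with from first ≟ᶠ x
    ... | no a₁≢x  = inj₂ (spans⇒good (endNotX first) (spansBeforeX first a₁≢x) xSpans)
    ... | yes a₁≡x = inj₂ (spans⇒good (endNotX second)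
                                     (spansBeforeX second (λ a₂≡x → distinct (trans a₁≡x (sym a₂≡x) , b₁≡b₂)))
                                     xSpans)

  sameBC-later⇒good : ∀ {x z} → SameBC G x z → α x < α z → Good (α x) ⊎ Good (pred (α x))
  sameBC-later⇒good {x} {z} x~z x<z =
    decidable-stable (good? (α x) ⊎-dec good? (pred (α x))) (byEarlierNeighbour earlier?)
    where
    earlier? : Dec (∃[ a ] E G x a × α a < α x)
    earlier? = any? (λ a → (adj G x a Bool.≟ true) ×-dec (α a <? α x))
    byEarlierNeighbour : Dec (∃[ a ] E G x a × α a < α x) → ¬ ¬ (Good (α x) ⊎ Good (pred (α x)))
    byEarlierNeighbour (yes (a , xa , a<x)) =
      ¬¬-map (earlierNeighbour⇒good (E-sym G xa) a<x)
             (sameBC⇒twoCrossings G (λ w → α w ≤? α x) x~z ≤-refl (<⇒≱ x<z))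
    byEarlierNeighbour (no noEarlier) =
      ¬¬-map (inj₁ ∘ noEarlierNeighbour⇒good (λ xa → ≮⇒≥ (λ a<x → noEarlier (_ , xa , a<x))))
             (sameBC⇒twoCrossings G (_≟ᶠ x) x~z refl (λ z≡x → <-irrefl (cong α (sym z≡x)) x<z))

  GoodNear : ℕ → Set
  GoodNear p = ∃[ q ] Good q × Between q (3 + q) p

  good-or-pred⇒goodNear : ∀ {p r} → p ≤ r → r ≤ suc p → Good p ⊎ Good (pred p) → GoodNear r
  good-or-pred⇒goodNear {p} p≤r r≤1+p (inj₁ good) = p , good , p≤r , s≤s (m≤n⇒m≤1+n r≤1+p)
  good-or-pred⇒goodNear {p} p≤r r≤1+p (inj₂ good) =
    pred p , good , ≤-trans pred[n]≤n p≤r , s≤s (≤-trans r≤1+p (s≤s (n≤1+pred[n] p)))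

  charge : Fin n → ℕ
  charge v = ∑[ q < n ] (𝟙 (good? (toℕ q)) * 𝟙 (between? (toℕ q) (3 + toℕ q) (α v)))

  goodNear⇒charge≥1 : ∀ {v} → GoodNear (α v) → 1 ≤ charge v
  goodNear⇒charge≥1 {v} (q , good , window) =
    ≤-trans (≤-reflexive (sym term≡1))
            (term≤∑ (λ i → 𝟙 (good? (toℕ i)) * 𝟙 (between? (toℕ i) (3 + toℕ i) (α v))) (fromℕ< q<n))
    where
    q<n : q < n
    q<n = ≤-<-trans (proj₁ window) (toℕ<n (π ⟨$⟩ʳ v))
    term≡1 : 𝟙 (good? (toℕ (fromℕ< q<n))) * 𝟙 (between? (toℕ (fromℕ< q<n)) (3 + toℕ (fromℕ< q<n)) (α v)) ≡ 1
    term≡1 rewrite toℕ-fromℕ< q<n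
                 | 𝟙-yes (good? q) good
                 | 𝟙-yes (between? q (3 + q) (α v)) window = refl

  ∑charge≤3*goodGaps : ∑[ v < n ] charge v ≤ 3 * goodGaps
  ∑charge≤3*goodGaps = begin
    ∑[ v < n ] ∑[ q < n ] (good q * window q v)   ≡⟨ ∑-comm {n} {n} (λ v q → good q * window q v) ⟩
    ∑[ q < n ] ∑[ v < n ] (good q * window q v)   ≡⟨ sum-cong-≗ (λ q → *-distribˡ-sum (good q) (window q)) ⟨
    ∑[ q < n ] (good q * ∑[ v < n ] window q v)   ≤⟨ ∑-mono-≤ {n} (λ q → *-monoʳ-≤ (good q) (atMostThree q)) ⟩
    ∑[ q < n ] (good q * 3)                       ≡⟨ *-distribʳ-sum 3 good ⟨
    goodGaps * 3                                  ≡⟨ *-comm goodGaps 3 ⟩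
    3 * goodGaps                                  ∎
    where
    open ≤-Reasoning
    good : Fin n → ℕ
    good q = 𝟙 (good? (toℕ q))
    window : Fin n → Fin n → ℕ
    window q v = 𝟙 (between? (toℕ q) (3 + toℕ q) (α v))
    atMostThree : ∀ q → ∑[ v < n ] window q v ≤ 3
    atMostThree q = ≤-trans (∑-between-ord≤ π (toℕ q) (3 + toℕ q)) (≤-reflexive (m+n∸n≡m 3 (toℕ q)))

inNontrivial⇒partner : ∀ {n t} (c : Fin n → Fin t) {v} → T (inNontrivial c v) → ∃[ u ] u ≢ v × c u ≡ c v
inNontrivial⇒partner {n} c {v} nontrivial with satisfied (any⁻ _ (allFin n) nontrivial)
... | u , partner with u ≟ᶠ v | c u ≟ᶠ c v | partner
... | no u≢v | yes cu≡cv | _  = u , u≢v , cu≡cv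
... | yes _  | _         | ()
... | no _   | no _      | ()

module _ {n t : ℕ} {G : Graph n} {c : Fin n → Fin t} (chain : IsChain G t c)
         (π : Permutation′ n) (special : Special c π) where

  open Gaps G π
  open IsChain chain

  -- Without a later vertex in its component, v directly follows a vertex of
  -- that component, namely the one at position α v - 1.
  nontrivial⇒goodNear : ∀ {u v} → u ≢ v → c u ≡ c v → GoodNear (α v)
  nontrivial⇒goodNear {u} {v} u≢v cu≡cv = byLater (any? (λ z → (c z ≟ᶠ c v) ×-dec (α v <? α z)))
    where
    byLater : Dec (∃[ z ] c z ≡ c v × α v < α z) → GoodNear (α v)
    byLater (yes (z , cz≡cv , v<z)) =
      good-or-pred⇒goodNear ≤-refl (n≤1+n _) (sameBC-later⇒good (c-sound v z (sym cz≡cv)) v<z)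
    byLater (no noLater) = viaPredecessor (ord-surjective π (≤-<-trans pred[n]≤n (toℕ<n (π ⟨$⟩ʳ v))))
      where
      u<v : α u < α v
      u<v = ≰⇒> (λ v≤u → noLater (u , cu≡cv , ≤∧≢⇒< v≤u (u≢v ∘ ord-injective π ∘ sym)))
      viaPredecessor : ∃[ x ] α x ≡ pred (α v) → GoodNear (α v)
      viaPredecessor (x , x≡v-1) =
        good-or-pred⇒goodNear x≤v v≤1+x (sameBC-later⇒good (c-sound x v cx≡cv) x<v)
        where
        x≤v : α x ≤ α v
        x≤v = ≤-trans (≤-reflexive x≡v-1) pred[n]≤n
        v≤1+x : α v ≤ suc (α x)
        v≤1+x = ≤-trans (n≤1+pred[n] (α v)) (s≤s (≤-reflexive (sym x≡v-1)))
        x<v : α x < α v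
        x<v = ≤-<-trans (≤-reflexive x≡v-1) (m<n⇒pred[n]<n u<v)
        cx≡cv : c x ≡ c v
        cx≡cv = special⇒contiguous π special cu≡cv (≤-trans (<⇒≤pred u<v) (≤-reflexive (sym x≡v-1))) x≤v

  eta≤∑charge : eta c ≤ ∑[ v < n ] charge v
  eta≤∑charge = begin
    eta c                             ≤⟨ length-filterᵇ≤sum-map (inNontrivial c) charge 1≤charge (allFin n) ⟩
    List.sum (map charge (allFin n))  ≡⟨ sum-map-tabulate charge (λ v → v) ⟩
    ∑[ v < n ] charge v               ∎
    where
    open ≤-Reasoning
    1≤charge : ∀ v → T (inNontrivial c v) → 1 ≤ charge v
    1≤charge v nontrivial with inNontrivial⇒partner c nontrivial
    ... | u , u≢v , cu≡cv = goodNear⇒charge≥1 (nontrivial⇒goodNear u≢v cu≡cv)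

lemma2p7 : ∀ {n : ℕ} (k : ℕ) → 1 ≤ k → (G : Graph n) (t : ℕ) (c : Fin n → Fin t) → IsChain G t c → (π : Permutation′ n) → Special c π → profile G π ≤ n ∸ 1 + k → eta c ≤ 3 * k
lemma2p7 {n} k _ G t c chain π special profile≤ = begin
  eta c                ≤⟨ eta≤∑charge chain π special ⟩
  ∑[ v < n ] charge v  ≤⟨ ∑charge≤3*goodGaps ⟩
  3 * goodGaps         ≤⟨ *-monoʳ-≤ 3 goodGaps≤k ⟩
  3 * k                ∎
  where
  open Gaps G π
  open ≤-Reasoning
  goodGaps≤k : goodGaps ≤ k
  goodGaps≤k = +-cancelˡ-≤ (n ∸ 1) goodGaps k
                 (≤-trans (n∸1+goodGaps≤profile (IsChain.connected chain)) profile≤)
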